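{- The $\mathbb{Q}$-linear map $\phi:\mathfrak{A}_2^1\to\mathbb{Q}\otimes\mathrm{QSym}_2$ given by $\phi(\mathbf{1})=1$ and $\phi(W(\mathbf{s}))=M_{\mathbf{s}}$ for every $\mathbf{s}\in\mathbb{D}^d$, $d\ge1$, is an isomorphism of algebras from $(\mathfrak{A}_2^1,*)$ onto $\mathbb{Q}\otimes\mathrm{QSym}_2$.
   Context: Signed numbers: $\mathbb{D}=\mathbb{N}\cup\{\bar k:k\in\mathbb{N}\}$, $|k|=|\bar k|=k$, $\operatorname{sgn}(k)=1$, $\operatorname{sgn}(\bar k)=-1$; $a\oplus b$ is $\overline{|a|+|b|}$ if $\operatorname{sgn}(a)\neq\operatorname{sgn}(b)$ and $|a|+|b|$ otherwise; also $0\oplus e=e$. Words: $\mathfrak{A}_2^1$ is the free $\mathbb{Q}$-algebra (noncommutative) on letters $y_{n,\mu}$, $n\in\mathbb{N}$, $\mu\in\{\pm1\}$ (here $y_{n,\mu}=x_0^{n-1}x_\mu$), with empty word $\mathbf{1}$; $W(\mathbf{s})=y_{|s_1|,\operatorname{sgn}(s_1)}\cdots y_{|s_d|,\operatorname{sgn}(s_d)}$. Stuffle product: bilinear with $\mathbf{1}*\mathbf{w}=\mathbf{w}*\mathbf{1}=\mathbf{w}$ and $y_{m,\mu}\mathbf{u}*y_{n,\nu}\mathbf{v}=y_{m,\mu}(\mathbf{u}*y_{n,\nu}\mathbf{v})+y_{n,\nu}(y_{m,\mu}\mathbf{u}*\mathbf{v})+y_{m+n,\mu\nu}(\mathbf{u}*\mathbf{v})$.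 Quasi-symmetric functions with signed powers: consider formal series in commuting variables $x_1,x_2,\dots$ whose monomials are $x_{i_1}^{e_1}\cdots x_{i_n}^{e_n}$ with distinct indices and exponents $e_j\in\mathbb{D}$, with multiplication rule $x_j^{e}x_j^{e'}=x_j^{e\oplus e'}$, and degree $\deg(x_{i_1}^{e_1}\cdots x_{i_n}^{e_n})=\sum|e_j|$. $\mathrm{QSym}_2$ is the set of such series with integer coefficients and bounded degree such that, for any $i_1>\dots>i_d$, $j_1>\dots>j_d$ and $e_1,\dots,e_d\in\mathbb{D}$, the monomials $x_{i_1}^{e_1}\cdots x_{i_d}^{e_d}$ and $x_{j_1}^{e_1}\cdots x_{j_d}^{e_d}$ have the same coefficient. For $\mathbf{s}\in\mathbb{D}^d$, $M_{\mathbf{s}}=\sum_{k_1>\dots>k_d\ge1}x_{k_1}^{s_1}\cdots x_{k_d}^{s_d}$. -}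

module Defs where

open import Data.Nat as ℕ using (ℕ; zero; suc; _<_; _+_)
open import Data.Nat.Properties as ℕP using (<-trans)
open import Data.Integer as ℤ using (ℤ)
open import Data.Rational as ℚ using (ℚ; 0ℚ; 1ℚ; _/_)
open import Data.Sign as Sign using (Sign)
open import Data.List using (List; []; _∷_; map; concatMap; filter; foldr; _++_; upTo; [_])
open import Data.Product using (Σ; ∃; ∃-syntax; _×_; _,_; proj₁; proj₂)
open import Data.Unit using (⊤; tt)
open import Data.Bool using (if_then_else_)
open import Relation.Nullary using (Dec; yes; no; does)
open import Relation.Nullary.Decidable using (map′)
open import Relation.Binary.PropositionalEquality using (_≡_; refl; cong₂)
open import Relation.Binary using (DecidableEquality)
import Data.List.Properties as LP
import Data.Product.Properties as PP

-- Signed numbers 𝔻 (nonzero): sd s k has absolute value k+1 and sign s.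
-- sd + k  is the positive integer k+1,  sd - k  is  \overline{k+1}.

data 𝔻 : Set where
  sd : Sign → ℕ → 𝔻

∣_∣ᴰ : 𝔻 → ℕ
∣ sd _ k ∣ᴰ = suc k

sgn : 𝔻 → Sign
sgn (sd s _) = s

-- a ⊕ b : absolute value |a|+|b|, sign negative iff signs differ
-- (Sign._*_ gives + on equal signs and - on different signs).
_⊕_ : 𝔻 → 𝔻 → 𝔻
sd s k ⊕ sd t l = sd (s Sign.* t) (suc (k + l))

_≟ᴰ_ : DecidableEquality 𝔻
sd s k ≟ᴰ sd t l = map′ (λ { refl → refl }) (λ { refl → refl })
                         (PP.≡-dec Sign._≟_ ℕ._≟_ (s , k) (t , l))

-- The word algebra 𝔄₂¹ (underlying ℚ-vector space).
-- Letter  y n μ  stands for  y_{n+1,μ} = x_0^n x_μ.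

data Letter : Set where
  y : ℕ → Sign → Letter

Word : Set
Word = List Letter

_≟ᴸ_ : DecidableEquality Letter
y n μ ≟ᴸ y m ν = map′ (λ { refl → refl }) (λ { refl → refl })
                      (PP.≡-dec ℕ._≟_ Sign._≟_ (n , μ) (m , ν))

_≟ᵂ_ : DecidableEquality Word
_≟ᵂ_ = LP.≡-dec _≟ᴸ_

letterOf : 𝔻 → Letter
letterOf (sd s k) = y k s

W : List 𝔻 → Word
W = map letterOf

unW : Word → List 𝔻
unW = map (λ { (y k s) → sd s k })

-- An element of 𝔄₂¹ is a formal finite ℚ-linear combination of words;
-- two such are equal when all their word coefficients agree.
𝔄 : Set
𝔄 = List (ℚ × Word)

coeff : 𝔄 → Word → ℚ
coeff [] w = 0ℚ
coeff ((q , u) ∷ x) w = if does (u ≟ᵂ w) then q ℚ.+ coeff x w else coeff x w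

_≈𝔄_ : 𝔄 → 𝔄 → Set
x ≈𝔄 x′ = ∀ w → coeff x w ≡ coeff x′ w

one𝔄 : 𝔄
one𝔄 = [ (1ℚ , []) ]

_+𝔄_ : 𝔄 → 𝔄 → 𝔄
_+𝔄_ = _++_

_·𝔄_ : ℚ → 𝔄 → 𝔄
q ·𝔄 x = map (λ { (r , u) → (q ℚ.* r , u) }) x

prepend : Letter → 𝔄 → 𝔄
prepend a = map (λ { (q , u) → (q , a ∷ u) })

-- y_{m,μ} and y_{n,ν} give y_{m+n,μν}
_⊞_ : Letter → Letter → Letter
y m μ ⊞ y n ν = y (suc (m + n)) (μ Sign.* ν)

stuffleW : Word → Word → 𝔄
stuffleW [] v = [ (1ℚ , v) ]
stuffleW (a ∷ u) [] = [ (1ℚ , a ∷ u) ]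
stuffleW (a ∷ u) (b ∷ v) =
  prepend a (stuffleW u (b ∷ v)) ++ prepend b (stuffleW (a ∷ u) v)
    ++ prepend (a ⊞ b) (stuffleW u v)

_⋆_ : 𝔄 → 𝔄 → 𝔄
x ⋆ x′ = concatMap (λ { (q , u) → concatMap (λ { (r , v) → (q ℚ.* r) ·𝔄 stuffleW u v }) x′ }) x

-- Monomials x_{i_1}^{e_1} ⋯ x_{i_n}^{e_n} with i_1 > ⋯ > i_n ≥ 1, e_j ∈ 𝔻,
-- stored as the list ((i_1,e_1) , … , (i_n,e_n)) (strictly decreasing indices).

data Bnd : Set where
  ∞ : Bnd
  fin : ℕ → Bnd

_<ᵇ_ : ℕ → Bnd → Set
i <ᵇ ∞ = ⊤
i <ᵇ fin b = i < b

DecBelow : Bnd → List (ℕ × 𝔻) → Set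
DecBelow b [] = ⊤
DecBelow b ((i , e) ∷ r) = (0 < i) × (i <ᵇ b) × DecBelow (fin i) r

record BMon (b : Bnd) : Set where
  constructor mon
  field
    terms : List (ℕ × 𝔻)
    .dec : DecBelow b terms
open BMon public

Monomial : Set
Monomial = BMon ∞

deg : Monomial → ℕ
deg m = foldr _+_ 0 (map (λ p → ∣ proj₂ p ∣ᴰ) (terms m))

exps : Monomial → List 𝔻
exps m = map proj₂ (terms m)

private
  <ᵇ-trans : ∀ {k i} b → k < i → i <ᵇ b → k <ᵇ b
  <ᵇ-trans ∞ _ _ = tt
  <ᵇ-trans (fin b) p q = <-trans p q

  weakenDec : ∀ {i} b t → i <ᵇ b → DecBelow (fin i) t → DecBelow b t
  weakenDec b [] _ _ = tt
  weakenDec b ((k , e) ∷ r) ib (p , ki , d) = p , <ᵇ-trans b ki ib , d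

weaken : ∀ {i} b → .(i <ᵇ b) → BMon (fin i) → BMon b
weaken b ib (mon t d) = mon t (weakenDec b t ib d)

consM : ∀ b (i : ℕ) (e : 𝔻) → .(0 < i) → .(i <ᵇ b) → BMon (fin i) → BMon b
consM b i e p ib (mon t d) = mon ((i , e) ∷ t) (p , ib , d)

emptyM : ∀ {b} → BMon b
emptyM = mon [] tt

splits : 𝔻 → List (𝔻 × 𝔻)
splits e = filter (λ p → (proj₁ p ⊕ proj₂ p) ≟ᴰ e)
  (concatMap (λ s₁ → concatMap (λ s₂ → concatMap (λ a →
     map (λ c → (sd s₁ a , sd s₂ c)) (upTo ∣ e ∣ᴰ)) (upTo ∣ e ∣ᴰ))
     (Sign.+ ∷ Sign.- ∷ [])) (Sign.+ ∷ Sign.- ∷ []))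

-- all factorisations m = m₁ · m₂ of a monomial (using x_j^e x_j^{e'} = x_j^{e ⊕ e'}):
-- each variable of m goes entirely into m₁, entirely into m₂, or is split
factorsB : ∀ b (t : List (ℕ × 𝔻)) → .(DecBelow b t) → List (BMon b × BMon b)
factorsB b [] _ = [ (emptyM , emptyM) ]
factorsB b ((i , e) ∷ r) d = concatMap opts (factorsB (fin i) r (proj₂ (proj₂ d)))
  where
  opts : BMon (fin i) × BMon (fin i) → List (BMon b × BMon b)
  opts (L , R) =
      (consM b i e (proj₁ d) (proj₁ (proj₂ d)) L , weaken b (proj₁ (proj₂ d)) R)
    ∷ (weaken b (proj₁ (proj₂ d)) L , consM b i e (proj₁ d) (proj₁ (proj₂ d)) R)
    ∷ map (λ { (e₁ , e₂) → (consM b i e₁ (proj₁ d) (proj₁ (proj₂ d)) L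
                          , consM b i e₂ (proj₁ d) (proj₁ (proj₂ d)) R) }) (splits e)

factors : Monomial → List (Monomial × Monomial)
factors (mon t d) = factorsB ∞ t d

Series : Set
Series = Monomial → ℚ

_≗ₛ_ : Series → Series → Set
f ≗ₛ g = ∀ m → f m ≡ g m

_+ₛ_ : Series → Series → Series
(f +ₛ g) m = f m ℚ.+ g m

_·ₛ_ : ℚ → Series → Series
(q ·ₛ f) m = q ℚ.* f m

_*ₛ_ : Series → Series → Series
(f *ₛ g) m = foldr ℚ._+_ 0ℚ (map (λ { (m₁ , m₂) → f m₁ ℚ.* g m₂ }) (factors m))

oneₛ : Series
oneₛ m = if does (terms m ≟ₗ []) then 1ℚ else 0ℚ
  where _≟ₗ_ = LP.≡-dec (PP.≡-dec ℕ._≟_ _≟ᴰ_)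

-- M_s = Σ_{k_1>⋯>k_d≥1} x_{k_1}^{s_1} ⋯ x_{k_d}^{s_d}
M : List 𝔻 → Series
M s m = if does (exps m ≟ₑ s) then 1ℚ else 0ℚ
  where _≟ₑ_ = LP.≡-dec _≟ᴰ_

IsQSym₂ : (Monomial → ℤ) → Set
IsQSym₂ g =
    (∃[ N ] ∀ m → N < deg m → g m ≡ ℤ.0ℤ)
  × (∀ m m′ → exps m ≡ exps m′ → g m ≡ g m′)

-- ℚ ⊗ QSym₂, realised (via the injective map ℚ ⊗ QSym₂ → ℚ-series)
-- as the series of the form (1/(n+1)) g with g ∈ QSym₂.
InℚQSym₂ : Series → Set
InℚQSym₂ f = ∃[ n ] Σ (Monomial → ℤ) λ g → IsQSym₂ g × (∀ m → f m ≡ g m / suc n)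

φW : Word → Series
φW [] = oneₛ
φW (a ∷ u) = M (unW (a ∷ u))

φ : 𝔄 → Series
φ [] m = 0ℚ
φ ((q , u) ∷ x) m = q ℚ.* φW u m ℚ.+ φ x m

{-# OPTIONS --safe #-}
-- By linearity it suffices to compare coefficients: φ x has at a monomial m the coefficient of
-- x at the word of exponents of m, so φ is linear, injective (test it on one monomial per
-- exponent sequence) and onto the bounded quasi-symmetric series (interpolate their finitely
-- many coefficient values).  For products, the coefficient of m in M_u M_v counts the
-- factorisations m = m₁ m₂ with exponent words u and v.  The leading variable x_i^e of m goes to
-- m₁, to m₂, or splits as x_i^{e₁} x_i^{e₂} with e₁ ⊕ e₂ = e; these three cases are exactly
-- the three terms of the stuffle recursion, so induction on m gives φ(u * v) = M_u M_v.
module Submission where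

open import Algebra.Bundles using (CommutativeSemiring; CommutativeRing)
open import Data.Bool using (true; false; if_then_else_)
open import Data.List using (List; []; _∷_; [_]; map; concatMap; filter; foldr; _++_; _∷ʳ_; upTo; length)
import Data.List.Properties as List
open import Data.Product using (Σ; ∃-syntax; _×_; _,_; proj₁; proj₂)
open import Function using (_∘_)
open import Relation.Binary.PropositionalEquality as ≡ using (_≡_)
open import Relation.Nullary using (¬_; Dec; yes; no; does; contradiction)
open import Relation.Nullary.Decidable using (_×-dec_)
open import Relation.Unary using (Decidable)

module ListSum {c ℓ} (R : CommutativeSemiring c ℓ) where

  open CommutativeSemiring R
  open import Relation.Binary.Reasoning.Setoid setoid

  private variable
    A B : Set

  ∑ : (A → Carrier) → List A → Carrier
  ∑ h xs = foldr _+_ 0# (map h xs)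

  ∑-cong : ∀ {f g : A → Carrier} → (∀ x → f x ≈ g x) → ∀ xs → ∑ f xs ≈ ∑ g xs
  ∑-cong eq []       = refl
  ∑-cong eq (x ∷ xs) = +-cong (eq x) (∑-cong eq xs)

  ∑-map : ∀ (h : B → Carrier) (f : A → B) xs → ∑ h (map f xs) ≡ ∑ (h ∘ f) xs
  ∑-map h f xs = ≡.cong (foldr _+_ 0#) (≡.sym (List.map-∘ xs))

  ∑-++ : ∀ (h : A → Carrier) xs ys → ∑ h (xs ++ ys) ≈ ∑ h xs + ∑ h ys
  ∑-++ h []       ys = sym (+-identityˡ _)
  ∑-++ h (x ∷ xs) ys = begin
    h x + ∑ h (xs ++ ys)        ≈⟨ +-congˡ (∑-++ h xs ys) ⟩
    h x + (∑ h xs + ∑ h ys)     ≈⟨ +-assoc _ _ _ ⟨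
    h x + ∑ h xs + ∑ h ys       ∎

  ∑-concatMap : ∀ (h : B → Carrier) (f : A → List B) xs → ∑ h (concatMap f xs) ≈ ∑ (∑ h ∘ f) xs
  ∑-concatMap h f []       = refl
  ∑-concatMap h f (x ∷ xs) = trans (∑-++ h (f x) (concatMap f xs)) (+-congˡ (∑-concatMap h f xs))

  ∑-0 : ∀ (xs : List A) → ∑ (λ _ → 0#) xs ≈ 0#
  ∑-0 []       = refl
  ∑-0 (x ∷ xs) = trans (+-identityˡ _) (∑-0 xs)

  ∑-+ : ∀ (f g : A → Carrier) xs → ∑ (λ x → f x + g x) xs ≈ ∑ f xs + ∑ g xs
  ∑-+ f g []       = sym (+-identityˡ 0#)
  ∑-+ f g (x ∷ xs) = trans (+-congˡ (∑-+ f g xs)) (+-interchange _ _ _ _)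
    where open import Algebra.Properties.CommutativeSemigroup +-commutativeSemigroup
            renaming (interchange to +-interchange)

  ∑-*ˡ : ∀ a (f : A → Carrier) xs → ∑ (λ x → a * f x) xs ≈ a * ∑ f xs
  ∑-*ˡ a f []       = sym (zeroʳ a)
  ∑-*ˡ a f (x ∷ xs) = trans (+-congˡ (∑-*ˡ a f xs)) (sym (distribˡ a _ _))

  ∑-*ʳ : ∀ a (f : A → Carrier) xs → ∑ (λ x → f x * a) xs ≈ ∑ f xs * a
  ∑-*ʳ a f []       = sym (zeroˡ a)
  ∑-*ʳ a f (x ∷ xs) = trans (+-congˡ (∑-*ʳ a f xs)) (sym (distribʳ a _ _))

  ∑-swap : ∀ (f : A → B → Carrier) xs ys →
           ∑ (λ x → ∑ (f x) ys) xs ≈ ∑ (λ y → ∑ (λ x → f x y) xs) ys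
  ∑-swap f []       ys = sym (∑-0 ys)
  ∑-swap f (x ∷ xs) ys =
    trans (+-congˡ (∑-swap f xs ys)) (sym (∑-+ (f x) (λ y → ∑ (λ x → f x y) xs) ys))

  ∑∑-* : ∀ (f : A → Carrier) (g : B → Carrier) xs ys →
         ∑ (λ x → ∑ (λ y → f x * g y) ys) xs ≈ ∑ f xs * ∑ g ys
  ∑∑-* f g xs ys = trans (∑-cong (λ x → ∑-*ˡ (f x) g ys) xs) (∑-*ʳ (∑ g ys) f xs)

  ∑-filter : ∀ {P : A → Set} (P? : Decidable P) (h : A → Carrier) xs →
             ∑ h (filter P? xs) ≈ ∑ (λ x → if does (P? x) then h x else 0#) xs
  ∑-filter P? h []       = refl
  ∑-filter P? h (x ∷ xs) with does (P? x)
  ... | true  = +-congˡ (∑-filter P? h xs)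
  ... | false = trans (∑-filter P? h xs) (sym (+-identityˡ _))

  𝟙 : ∀ {P : Set} → Dec P → Carrier
  𝟙 p = if does p then 1# else 0#

  𝟙-iff : ∀ {P Q : Set} (p : Dec P) (q : Dec Q) → (P → Q) → (Q → P) → 𝟙 p ≡ 𝟙 q
  𝟙-iff (yes _) (yes _) _   _   = ≡.refl
  𝟙-iff (no _)  (no _)  _   _   = ≡.refl
  𝟙-iff (yes x) (no ¬y) x→y _   with () ← ¬y (x→y x)
  𝟙-iff (no ¬x) (yes y) _   y→x with () ← ¬x (y→x y)

  𝟙-yes : ∀ {P : Set} (p : Dec P) → P → 𝟙 p ≡ 1#
  𝟙-yes (yes _) _ = ≡.refl
  𝟙-yes (no ¬x) x with () ← ¬x x

  𝟙-no : ∀ {P : Set} (p : Dec P) → ¬ P → 𝟙 p ≡ 0#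
  𝟙-no (yes x) ¬x with () ← ¬x x
  𝟙-no (no _)  _  = ≡.refl

  𝟙-× : ∀ {P Q : Set} (p : Dec P) (q : Dec Q) → 𝟙 (p ×-dec q) ≈ 𝟙 p * 𝟙 q
  𝟙-× (yes _) (yes _) = sym (*-identityˡ 1#)
  𝟙-× (yes _) (no _)  = sym (zeroʳ 1#)
  𝟙-× (no _)  q       = sym (zeroˡ (𝟙 q))

  if-then-0 : ∀ {P : Set} (p : Dec P) x → (if does p then x else 0#) ≈ 𝟙 p * x
  if-then-0 (yes _) x = sym (*-identityˡ x)
  if-then-0 (no _)  x = sym (zeroˡ x)

  *-𝟙-cong : ∀ {P : Set} (p : Dec P) x y → (P → x ≈ y) → x * 𝟙 p ≈ y * 𝟙 p
  *-𝟙-cong (yes p) x y x≈y = *-congʳ (x≈y p)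
  *-𝟙-cong (no _)  x y _   = trans (zeroʳ x) (sym (zeroʳ y))

open import Data.Integer as ℤ using (ℤ)
import Data.Integer.Properties as ℤ
open import Data.List.Relation.Unary.Any as Any using (here; there)
open import Data.List.Membership.Propositional using (_∈_)
open import Data.List.Membership.Propositional.Properties using (∈-map⁺; ∈-concatMap⁺; ∈-upTo⁺)
import Data.Nat as ℕ
open import Data.Nat using (ℕ; zero; suc; _<_; _≤_; z≤n; s≤s; _<?_)
open import Data.Nat.ListAction using (sum)
import Data.Nat.Properties as ℕ
open import Data.Rational using (ℚ; 0ℚ; 1ℚ; _+_; _*_; _-_; _/_; ↥_; ↧ₙ_)
import Data.Rational.Properties as ℚ
open import Data.Rational.Properties using (*-identityˡ; *-zeroˡ; *-zeroʳ; +-identityʳ)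
import Data.Rational.Unnormalised as ℚᵘ
import Data.Rational.Unnormalised.Properties as ℚᵘ
open import Data.Sign as Sign using (Sign)
import Data.Sign.Properties as Sign
open import Data.Unit using (tt)
open import Relation.Binary using (tri<; tri≈; tri>)
open ≡ using (_≢_; sym; trans; cong; cong₂; module ≡-Reasoning)

open import Defs
open import Data.List.Membership.DecPropositional (List.≡-dec _≟ᴰ_) using (_∈?_)

ℚ-semiring : CommutativeSemiring _ _
ℚ-semiring = CommutativeRing.commutativeSemiring ℚ.+-*-commutativeRing

open ListSum ℚ-semiring
open import Algebra.Properties.CommutativeSemigroup (CommutativeSemiring.*-commutativeSemigroup ℚ-semiring)
  using (interchange; x∙yz≈y∙xz)

δᵂ : Word → Word → ℚ
δᵂ u w = 𝟙 (u ≟ᵂ w)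

δᴸ : Letter → Letter → ℚ
δᴸ a c = 𝟙 (a ≟ᴸ c)

δᴰ : 𝔻 → 𝔻 → ℚ
δᴰ d e = 𝟙 (d ≟ᴰ e)

δᵂ-∷ : ∀ a u c w → δᵂ (a ∷ u) (c ∷ w) ≡ δᴸ a c * δᵂ u w
δᵂ-∷ a u c w = trans (𝟙-iff ((a ∷ u) ≟ᵂ (c ∷ w)) ((a ≟ᴸ c) ×-dec (u ≟ᵂ w)) List.∷-injective
                              λ { (≡.refl , ≡.refl) → ≡.refl })
                     (𝟙-× (a ≟ᴸ c) (u ≟ᵂ w))

δᴰ-sd : ∀ s α t β → δᴰ (sd s α) (sd t β) ≡ 𝟙 (s Sign.≟ t) * 𝟙 (α ℕ.≟ β)
δᴰ-sd s α t β = trans (𝟙-iff (sd s α ≟ᴰ sd t β) ((s Sign.≟ t) ×-dec (α ℕ.≟ β))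
                              (λ { ≡.refl → ≡.refl , ≡.refl }) λ { (≡.refl , ≡.refl) → ≡.refl })
                       (𝟙-× (s Sign.≟ t) (α ℕ.≟ β))

𝟙-<-suc : ∀ α n → 𝟙 (α <? n) + 𝟙 (α ℕ.≟ n) ≡ 𝟙 (α <? suc n)
𝟙-<-suc α n with ℕ.<-cmp α n
... | tri< α<n α≢n _ = trans (cong₂ _+_ (𝟙-yes (α <? n) α<n) (𝟙-no (α ℕ.≟ n) α≢n))
                             (sym (𝟙-yes (α <? suc n) (ℕ.m<n⇒m<1+n α<n)))
... | tri≈ α≮n α≡n _ = trans (cong₂ _+_ (𝟙-no (α <? n) α≮n) (𝟙-yes (α ℕ.≟ n) α≡n))
                             (sym (𝟙-yes (α <? suc n) (ℕ.≤-reflexive (cong suc α≡n))))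
... | tri> _ α≢n n<α = trans (cong₂ _+_ (𝟙-no (α <? n) (ℕ.<⇒≯ n<α)) (𝟙-no (α ℕ.≟ n) α≢n))
                             (sym (𝟙-no (α <? suc n) (ℕ.≤⇒≯ n<α)))

∑-δ-upTo : ∀ α n → ∑ (λ β → 𝟙 (α ℕ.≟ β)) (upTo n) ≡ 𝟙 (α <? n)
∑-δ-upTo α zero    = ≡.refl
∑-δ-upTo α (suc n) = begin
  ∑ δα (upTo (suc n))            ≡⟨ cong (∑ δα) (sym (List.upTo-∷ʳ n)) ⟩
  ∑ δα (upTo n ∷ʳ n)             ≡⟨ ∑-++ δα (upTo n) [ n ] ⟩
  ∑ δα (upTo n) + (δα n + 0ℚ)    ≡⟨ cong₂ _+_ (∑-δ-upTo α n) (+-identityʳ (δα n)) ⟩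
  𝟙 (α <? n) + δα n              ≡⟨ 𝟙-<-suc α n ⟩
  𝟙 (α <? suc n)                 ∎
  where
  open ≡-Reasoning
  δα : ℕ → ℚ
  δα β = 𝟙 (α ℕ.≟ β)

signs : List Sign
signs = Sign.+ ∷ Sign.- ∷ []

∑-δ-signs : ∀ σ → ∑ (λ s → 𝟙 (σ Sign.≟ s)) signs ≡ 1ℚ
∑-δ-signs Sign.+ = ≡.refl
∑-δ-signs Sign.- = ≡.refl

∑-δ-signed≤ : ∀ σ α k → ∑ (λ s → ∑ (λ β → δᴰ (sd σ α) (sd s β)) (upTo k)) signs ≡ 𝟙 (α <? k)
∑-δ-signed≤ σ α k = begin
  ∑ (λ s → ∑ (λ β → δᴰ (sd σ α) (sd s β)) (upTo k)) signs
    ≡⟨ ∑-cong (λ s → ∑-cong (δᴰ-sd σ α s) (upTo k)) signs ⟩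
  ∑ (λ s → ∑ (λ β → 𝟙 (σ Sign.≟ s) * 𝟙 (α ℕ.≟ β)) (upTo k)) signs
    ≡⟨ ∑∑-* (λ s → 𝟙 (σ Sign.≟ s)) (λ β → 𝟙 (α ℕ.≟ β)) signs (upTo k) ⟩
  ∑ (λ s → 𝟙 (σ Sign.≟ s)) signs * ∑ (λ β → 𝟙 (α ℕ.≟ β)) (upTo k)
    ≡⟨ cong₂ _*_ (∑-δ-signs σ) (∑-δ-upTo α k) ⟩
  1ℚ * 𝟙 (α <? k)
    ≡⟨ *-identityˡ _ ⟩
  𝟙 (α <? k) ∎
  where open ≡-Reasoning

candidates : ℕ → List (𝔻 × 𝔻)
candidates n = concatMap (λ s₁ → concatMap (λ s₂ → concatMap (λ α →
                 map (λ γ → (sd s₁ α , sd s₂ γ)) (upTo n)) (upTo n)) signs) signs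

∑-δ-candidates : ∀ σ α τ γ n → ∑ (λ (e₁ , e₂) → δᴰ (sd σ α) e₁ * δᴰ (sd τ γ) e₂) (candidates n)
                               ≡ 𝟙 (α <? n) * 𝟙 (γ <? n)
∑-δ-candidates σ α τ γ n = begin
  ∑ h (candidates n)
    ≡⟨ ∑-concatMap h (λ s₁ → concatMap (block s₁) signs) signs ⟩
  ∑ (λ s₁ → ∑ h (concatMap (block s₁) signs)) signs
    ≡⟨ ∑-cong (λ s₁ → trans (∑-concatMap h (block s₁) signs) (∑-cong (∑-block s₁) signs)) signs ⟩
  ∑ (λ s₁ → ∑ (λ s₂ → A s₁ * B s₂) signs) signs
    ≡⟨ ∑∑-* A B signs signs ⟩
  ∑ A signs * ∑ B signs
    ≡⟨ cong₂ _*_ (∑-δ-signed≤ σ α n) (∑-δ-signed≤ τ γ n) ⟩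
  𝟙 (α <? n) * 𝟙 (γ <? n) ∎
  where
  open ≡-Reasoning
  U = upTo n
  h : 𝔻 × 𝔻 → ℚ
  h (e₁ , e₂) = δᴰ (sd σ α) e₁ * δᴰ (sd τ γ) e₂
  block : Sign → Sign → List (𝔻 × 𝔻)
  block s₁ s₂ = concatMap (λ β → map (λ δ → (sd s₁ β , sd s₂ δ)) U) U
  A B : Sign → ℚ
  A s = ∑ (λ β → δᴰ (sd σ α) (sd s β)) U
  B s = ∑ (λ δ → δᴰ (sd τ γ) (sd s δ)) U
  ∑-block : ∀ s₁ s₂ → ∑ h (block s₁ s₂) ≡ A s₁ * B s₂
  ∑-block s₁ s₂ = begin
    ∑ h (block s₁ s₂)
      ≡⟨ ∑-concatMap h (λ β → map (λ δ → (sd s₁ β , sd s₂ δ)) U) U ⟩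
    ∑ (λ β → ∑ h (map (λ δ → (sd s₁ β , sd s₂ δ)) U)) U
      ≡⟨ ∑-cong (λ β → ∑-map h (λ δ → (sd s₁ β , sd s₂ δ)) U) U ⟩
    ∑ (λ β → ∑ (λ δ → δᴰ (sd σ α) (sd s₁ β) * δᴰ (sd τ γ) (sd s₂ δ)) U) U
      ≡⟨ ∑∑-* (λ β → δᴰ (sd σ α) (sd s₁ β)) (λ δ → δᴰ (sd τ γ) (sd s₂ δ)) U U ⟩
    A s₁ * B s₂ ∎

δᴸ-letterOf : ∀ d e → δᴸ (letterOf d) (letterOf e) ≡ δᴰ d e
δᴸ-letterOf (sd s k) (sd t l) = 𝟙-iff (y k s ≟ᴸ y l t) (sd s k ≟ᴰ sd t l)
                                      (λ { ≡.refl → ≡.refl }) (λ { ≡.refl → ≡.refl })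

-- The summand is the indicator of the single pair (a, b), which passes the filter exactly
-- when a ⊕ b = e, and then lies in the candidate range.
∑-splits : ∀ a b e → ∑ (λ (e₁ , e₂) → δᴸ a (letterOf e₁) * δᴸ b (letterOf e₂)) (splits e)
                     ≡ δᴸ (a ⊞ b) (letterOf e)
∑-splits (y α σ) (y γ τ) e@(sd s k) = begin
  ∑ (λ (e₁ , e₂) → δᴸ (letterOf a) (letterOf e₁) * δᴸ (letterOf b) (letterOf e₂)) (splits e)
    ≡⟨ ∑-cong (λ (e₁ , e₂) → cong₂ _*_ (δᴸ-letterOf a e₁) (δᴸ-letterOf b e₂)) (splits e) ⟩
  ∑ h (filter P? cands)
    ≡⟨ ∑-filter P? h cands ⟩
  ∑ (λ p → if does (P? p) then h p else 0ℚ) cands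
    ≡⟨ ∑-cong restrict cands ⟩
  ∑ (λ p → 𝟙 (P? (a , b)) * h p) cands
    ≡⟨ ∑-*ˡ (𝟙 (P? (a , b))) h cands ⟩
  𝟙 (P? (a , b)) * ∑ h cands
    ≡⟨ ℚ.*-comm (𝟙 (P? (a , b))) (∑ h cands) ⟩
  ∑ h cands * 𝟙 (P? (a , b))
    ≡⟨ *-𝟙-cong (P? (a , b)) (∑ h cands) 1ℚ inRange ⟩
  1ℚ * 𝟙 (P? (a , b))
    ≡⟨ *-identityˡ _ ⟩
  𝟙 (P? (a , b))
    ≡⟨ 𝟙-iff (P? (a , b)) (letterOf (a ⊕ b) ≟ᴸ letterOf e)
             (λ { ≡.refl → ≡.refl }) (λ { ≡.refl → ≡.refl }) ⟩
  δᴸ (y α σ ⊞ y γ τ) (letterOf e) ∎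
  where
  open ≡-Reasoning
  a b : 𝔻
  a = sd σ α
  b = sd τ γ
  cands : List (𝔻 × 𝔻)
  cands = candidates (suc k)
  P? : ∀ p → Dec ((proj₁ p ⊕ proj₂ p) ≡ e)
  P? p = (proj₁ p ⊕ proj₂ p) ≟ᴰ e
  h : 𝔻 × 𝔻 → ℚ
  h (e₁ , e₂) = δᴰ a e₁ * δᴰ b e₂
  restrict : ∀ p → (if does (P? p) then h p else 0ℚ) ≡ 𝟙 (P? (a , b)) * h p
  restrict p@(e₁ , e₂) = begin
    (if does (P? p) then h p else 0ℚ)          ≡⟨ if-then-0 (P? p) (h p) ⟩
    𝟙 (P? p) * h p                             ≡⟨ cong (𝟙 (P? p) *_) (sym (𝟙-× (a ≟ᴰ e₁) (b ≟ᴰ e₂))) ⟩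
    𝟙 (P? p) * 𝟙 (a ≟ᴰ e₁ ×-dec b ≟ᴰ e₂)       ≡⟨ *-𝟙-cong (a ≟ᴰ e₁ ×-dec b ≟ᴰ e₂) (𝟙 (P? p)) (𝟙 (P? (a , b)))
                                                            (λ { (≡.refl , ≡.refl) → ≡.refl }) ⟩
    𝟙 (P? (a , b)) * 𝟙 (a ≟ᴰ e₁ ×-dec b ≟ᴰ e₂) ≡⟨ cong (𝟙 (P? (a , b)) *_) (𝟙-× (a ≟ᴰ e₁) (b ≟ᴰ e₂)) ⟩
    𝟙 (P? (a , b)) * h p                       ∎
  inRange : (a ⊕ b) ≡ e → ∑ h cands ≡ 1ℚ
  inRange ≡.refl = trans (∑-δ-candidates σ α τ γ (suc k))
                         (cong₂ _*_ (𝟙-yes (α <? suc k) (ℕ.s≤s (ℕ.m≤n⇒m≤1+n (ℕ.m≤m+n α γ))))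
                                    (𝟙-yes (γ <? suc k) (ℕ.s≤s (ℕ.m≤n⇒m≤1+n (ℕ.m≤n+m γ α)))))

wordOf : ∀ {b} → BMon b → Word
wordOf L = W (map proj₂ (terms L))

coeff-∑ : ∀ x w → coeff x w ≡ ∑ (λ (q , u) → q * δᵂ u w) x
coeff-∑ []            w = ≡.refl
coeff-∑ ((q , u) ∷ x) w with u ≟ᵂ w
... | yes _ = cong₂ _+_ (sym (ℚ.*-identityʳ q)) (coeff-∑ x w)
... | no _  = trans (coeff-∑ x w) (sym (trans (cong (_+ _) (*-zeroʳ q)) (ℚ.+-identityˡ _)))

φ-∑ : ∀ x m → φ x m ≡ ∑ (λ (q , u) → q * φW u m) x
φ-∑ []            m = ≡.refl
φ-∑ ((q , u) ∷ x) m = cong (q * φW u m +_) (φ-∑ x m)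

W-unW : ∀ w → W (unW w) ≡ w
W-unW []            = ≡.refl
W-unW (y k s ∷ w) = cong (y k s ∷_) (W-unW w)

unW-W : ∀ s → unW (W s) ≡ s
unW-W []             = ≡.refl
unW-W (sd σ k ∷ s) = cong (sd σ k ∷_) (unW-W s)

φW-δ : ∀ u m → φW u m ≡ δᵂ u (wordOf m)
φW-δ []      (mon []      _) = ≡.refl
φW-δ []      (mon (_ ∷ _) _) = ≡.refl
φW-δ (a ∷ u) m = 𝟙-iff (List.≡-dec _≟ᴰ_ (exps m) (unW (a ∷ u))) ((a ∷ u) ≟ᵂ wordOf m)
  (λ eq → sym (trans (cong W eq) (W-unW (a ∷ u))))
  (λ eq → trans (sym (unW-W (exps m))) (cong unW (sym eq)))

φ-coeff : ∀ x m → φ x m ≡ coeff x (wordOf m)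
φ-coeff x m = begin
  φ x m                                          ≡⟨ φ-∑ x m ⟩
  ∑ (λ (q , u) → q * φW u m) x                   ≡⟨ ∑-cong (λ (q , u) → cong (q *_) (φW-δ u m)) x ⟩
  ∑ (λ (q , u) → q * δᵂ u (wordOf m)) x          ≡⟨ coeff-∑ x (wordOf m) ⟨
  coeff x (wordOf m)                             ∎
  where open ≡-Reasoning

coeff-++ : ∀ x x′ w → coeff (x ++ x′) w ≡ coeff x w + coeff x′ w
coeff-++ x x′ w = begin
  coeff (x ++ x′) w                      ≡⟨ coeff-∑ (x ++ x′) w ⟩
  ∑ c (x ++ x′)                          ≡⟨ ∑-++ c x x′ ⟩
  ∑ c x + ∑ c x′                         ≡⟨ cong₂ _+_ (coeff-∑ x w) (coeff-∑ x′ w) ⟨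
  coeff x w + coeff x′ w                 ∎
  where
  open ≡-Reasoning
  c : ℚ × Word → ℚ
  c (q , u) = q * δᵂ u w

coeff-prepend-[] : ∀ a x → coeff (prepend a x) [] ≡ 0ℚ
coeff-prepend-[] a []      = ≡.refl
coeff-prepend-[] a (_ ∷ x) = coeff-prepend-[] a x

coeff-prepend-∷ : ∀ a x c w → coeff (prepend a x) (c ∷ w) ≡ δᴸ a c * coeff x w
coeff-prepend-∷ a x c w = begin
  coeff (prepend a x) (c ∷ w)                    ≡⟨ coeff-∑ (prepend a x) (c ∷ w) ⟩
  ∑ (λ (q , u) → q * δᵂ u (c ∷ w)) (prepend a x) ≡⟨ ∑-map (λ (q , u) → q * δᵂ u (c ∷ w)) _ x ⟩
  ∑ (λ (q , u) → q * δᵂ (a ∷ u) (c ∷ w)) x       ≡⟨ ∑-cong (λ (q , u) → pull q u) x ⟩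
  ∑ (λ (q , u) → δᴸ a c * (q * δᵂ u w)) x        ≡⟨ ∑-*ˡ (δᴸ a c) (λ (q , u) → q * δᵂ u w) x ⟩
  δᴸ a c * ∑ (λ (q , u) → q * δᵂ u w) x          ≡⟨ cong (δᴸ a c *_) (coeff-∑ x w) ⟨
  δᴸ a c * coeff x w                             ∎
  where
  open ≡-Reasoning
  pull : ∀ q u → q * δᵂ (a ∷ u) (c ∷ w) ≡ δᴸ a c * (q * δᵂ u w)
  pull q u = trans (cong (q *_) (δᵂ-∷ a u c w)) (x∙yz≈y∙xz q (δᴸ a c) (δᵂ u w))

-- The recursion for the coefficient of c ∷ w in stuffleW u v, given the coefficients
-- Φ u′ v′ of w in the stuffles of the tails.
stuffleHead : Letter → (Word → Word → ℚ) → Word → Word → ℚ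
stuffleHead c Φ []      []      = 0ℚ
stuffleHead c Φ []      (b ∷ v) = δᴸ b c * Φ [] v
stuffleHead c Φ (a ∷ u) []      = δᴸ a c * Φ u []
stuffleHead c Φ (a ∷ u) (b ∷ v) = δᴸ a c * Φ u (b ∷ v) + (δᴸ b c * Φ (a ∷ u) v + δᴸ (a ⊞ b) c * Φ u v)

coeff-stuffleW-[]ˡ : ∀ v w → coeff (stuffleW [] v) w ≡ δᵂ v w
coeff-stuffleW-[]ˡ v w = trans (coeff-∑ (stuffleW [] v) w) (trans (+-identityʳ _) (*-identityˡ _))

coeff-stuffleW-[]ʳ : ∀ u w → coeff (stuffleW u []) w ≡ δᵂ u w
coeff-stuffleW-[]ʳ []      w = coeff-stuffleW-[]ˡ [] w
coeff-stuffleW-[]ʳ (a ∷ u) w = coeff-stuffleW-[]ˡ (a ∷ u) w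

coeff-stuffleW-∷ : ∀ c w u v → coeff (stuffleW u v) (c ∷ w) ≡ stuffleHead c (λ u′ v′ → coeff (stuffleW u′ v′) w) u v
coeff-stuffleW-∷ c w []      []      = ≡.refl
coeff-stuffleW-∷ c w []      (b ∷ v) = begin
  coeff (stuffleW [] (b ∷ v)) (c ∷ w)  ≡⟨ coeff-stuffleW-[]ˡ (b ∷ v) (c ∷ w) ⟩
  δᵂ (b ∷ v) (c ∷ w)                   ≡⟨ δᵂ-∷ b v c w ⟩
  δᴸ b c * δᵂ v w                      ≡⟨ cong (δᴸ b c *_) (coeff-stuffleW-[]ˡ v w) ⟨
  δᴸ b c * coeff (stuffleW [] v) w     ∎
  where open ≡-Reasoning
coeff-stuffleW-∷ c w (a ∷ u) []      = begin
  coeff (stuffleW (a ∷ u) []) (c ∷ w)  ≡⟨ coeff-stuffleW-[]ʳ (a ∷ u) (c ∷ w) ⟩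
  δᵂ (a ∷ u) (c ∷ w)                   ≡⟨ δᵂ-∷ a u c w ⟩
  δᴸ a c * δᵂ u w                      ≡⟨ cong (δᴸ a c *_) (coeff-stuffleW-[]ʳ u w) ⟨
  δᴸ a c * coeff (stuffleW u []) w     ∎
  where open ≡-Reasoning
coeff-stuffleW-∷ c w (a ∷ u) (b ∷ v) = begin
  coeff (X ++ Y ++ Z) (c ∷ w)
    ≡⟨ coeff-++ X (Y ++ Z) (c ∷ w) ⟩
  coeff X (c ∷ w) + coeff (Y ++ Z) (c ∷ w)
    ≡⟨ cong (coeff X (c ∷ w) +_) (coeff-++ Y Z (c ∷ w)) ⟩
  coeff X (c ∷ w) + (coeff Y (c ∷ w) + coeff Z (c ∷ w))
    ≡⟨ cong₂ _+_ (coeff-prepend-∷ a (stuffleW u (b ∷ v)) c w)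
                 (cong₂ _+_ (coeff-prepend-∷ b (stuffleW (a ∷ u) v) c w)
                            (coeff-prepend-∷ (a ⊞ b) (stuffleW u v) c w)) ⟩
  stuffleHead c (λ u′ v′ → coeff (stuffleW u′ v′) w) (a ∷ u) (b ∷ v) ∎
  where
  open ≡-Reasoning
  X Y Z : 𝔄
  X = prepend a (stuffleW u (b ∷ v))
  Y = prepend b (stuffleW (a ∷ u) v)
  Z = prepend (a ⊞ b) (stuffleW u v)

stuffleHead-∑ : ∀ {A : Set} c (Φ : Word → Word → ℚ) (Ψ : Word → Word → A → ℚ) xs →
                (∀ u v → Φ u v ≡ ∑ (Ψ u v) xs) →
                ∀ u v → stuffleHead c Φ u v ≡ ∑ (λ p → stuffleHead c (λ u′ v′ → Ψ u′ v′ p) u v) xs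
stuffleHead-∑ c Φ Ψ xs Φ≡∑Ψ = λ where
    []      []      → sym (∑-0 xs)
    []      (b ∷ v) → scaled (δᴸ b c) [] v
    (a ∷ u) []      → scaled (δᴸ a c) u []
    (a ∷ u) (b ∷ v) → begin
      δᴸ a c * Φ u (b ∷ v) + (δᴸ b c * Φ (a ∷ u) v + δᴸ (a ⊞ b) c * Φ u v)
        ≡⟨ cong₂ _+_ (scaled (δᴸ a c) u (b ∷ v))
                     (cong₂ _+_ (scaled (δᴸ b c) (a ∷ u) v) (scaled (δᴸ (a ⊞ b) c) u v)) ⟩
      ∑ (ψ (δᴸ a c) u (b ∷ v)) xs + (∑ (ψ (δᴸ b c) (a ∷ u) v) xs + ∑ (ψ (δᴸ (a ⊞ b) c) u v) xs)
        ≡⟨ cong (∑ (ψ (δᴸ a c) u (b ∷ v)) xs +_) (∑-+ (ψ (δᴸ b c) (a ∷ u) v) (ψ (δᴸ (a ⊞ b) c) u v) xs) ⟨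
      ∑ (ψ (δᴸ a c) u (b ∷ v)) xs + ∑ (λ p → ψ (δᴸ b c) (a ∷ u) v p + ψ (δᴸ (a ⊞ b) c) u v p) xs
        ≡⟨ ∑-+ (ψ (δᴸ a c) u (b ∷ v)) _ xs ⟨
      ∑ (λ p → stuffleHead c (λ u′ v′ → Ψ u′ v′ p) (a ∷ u) (b ∷ v)) xs ∎
  where
  open ≡-Reasoning
  ψ : ℚ → Word → Word → _ → ℚ
  ψ k u v p = k * Ψ u v p
  scaled : ∀ k u v → k * Φ u v ≡ ∑ (ψ k u v) xs
  scaled k u v = trans (cong (k *_) (Φ≡∑Ψ u v)) (sym (∑-*ˡ k (Ψ u v) xs))

∑-splits-[]ˡ : ∀ v e wL wR → ∑ (λ (e₁ , e₂) → δᵂ [] (letterOf e₁ ∷ wL) * δᵂ v (letterOf e₂ ∷ wR)) (splits e) ≡ 0ℚ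
∑-splits-[]ˡ v e wL wR = trans (∑-cong (λ (_ , e₂) → *-zeroˡ (δᵂ v (letterOf e₂ ∷ wR))) (splits e)) (∑-0 (splits e))

∑-splits-[]ʳ : ∀ u e wL wR → ∑ (λ (e₁ , e₂) → δᵂ u (letterOf e₁ ∷ wL) * δᵂ [] (letterOf e₂ ∷ wR)) (splits e) ≡ 0ℚ
∑-splits-[]ʳ u e wL wR = trans (∑-cong (λ (e₁ , _) → *-zeroʳ (δᵂ u (letterOf e₁ ∷ wL))) (splits e)) (∑-0 (splits e))

stuffleHead-splits : ∀ u v e wL wR →
    δᵂ u (letterOf e ∷ wL) * δᵂ v wR
  + (δᵂ u wL * δᵂ v (letterOf e ∷ wR)
  + ∑ (λ (e₁ , e₂) → δᵂ u (letterOf e₁ ∷ wL) * δᵂ v (letterOf e₂ ∷ wR)) (splits e))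
  ≡ stuffleHead (letterOf e) (λ u′ v′ → δᵂ u′ wL * δᵂ v′ wR) u v
stuffleHead-splits [] [] e wL wR =
  cong₂ _+_ (*-zeroˡ (δᵂ [] wR)) (cong₂ _+_ (*-zeroʳ (δᵂ [] wL)) (∑-splits-[]ˡ [] e wL wR))
stuffleHead-splits [] (b ∷ v) e wL wR = begin
  0ℚ * δᵂ (b ∷ v) wR + (δᵂ [] wL * δᵂ (b ∷ v) (c ∷ wR) + ∑ _ (splits e))
    ≡⟨ cong₂ _+_ (*-zeroˡ (δᵂ (b ∷ v) wR))
                 (cong₂ _+_ (cong (δᵂ [] wL *_) (δᵂ-∷ b v c wR)) (∑-splits-[]ˡ (b ∷ v) e wL wR)) ⟩
  0ℚ + (δᵂ [] wL * (δᴸ b c * δᵂ v wR) + 0ℚ)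
    ≡⟨ trans (ℚ.+-identityˡ _) (+-identityʳ _) ⟩
  δᵂ [] wL * (δᴸ b c * δᵂ v wR)
    ≡⟨ x∙yz≈y∙xz (δᵂ [] wL) (δᴸ b c) (δᵂ v wR) ⟩
  δᴸ b c * (δᵂ [] wL * δᵂ v wR) ∎
  where
  open ≡-Reasoning
  c = letterOf e
stuffleHead-splits (a ∷ u) [] e wL wR = begin
  δᵂ (a ∷ u) (c ∷ wL) * δᵂ [] wR + (δᵂ (a ∷ u) wL * 0ℚ + ∑ _ (splits e))
    ≡⟨ cong₂ _+_ (cong (_* δᵂ [] wR) (δᵂ-∷ a u c wL))
                 (cong₂ _+_ (*-zeroʳ (δᵂ (a ∷ u) wL)) (∑-splits-[]ʳ (a ∷ u) e wL wR)) ⟩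
  δᴸ a c * δᵂ u wL * δᵂ [] wR + (0ℚ + 0ℚ)
    ≡⟨ +-identityʳ _ ⟩
  δᴸ a c * δᵂ u wL * δᵂ [] wR
    ≡⟨ ℚ.*-assoc (δᴸ a c) (δᵂ u wL) (δᵂ [] wR) ⟩
  δᴸ a c * (δᵂ u wL * δᵂ [] wR) ∎
  where
  open ≡-Reasoning
  c = letterOf e
stuffleHead-splits (a ∷ u) (b ∷ v) e wL wR =
  cong₂ _+_ (trans (cong (_* δᵂ (b ∷ v) wR) (δᵂ-∷ a u c wL))
                   (ℚ.*-assoc (δᴸ a c) (δᵂ u wL) (δᵂ (b ∷ v) wR)))
  (cong₂ _+_ (trans (cong (δᵂ (a ∷ u) wL *_) (δᵂ-∷ b v c wR))
                    (x∙yz≈y∙xz (δᵂ (a ∷ u) wL) (δᴸ b c) (δᵂ v wR)))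
  (begin
    ∑ (λ (e₁ , e₂) → δᵂ (a ∷ u) (letterOf e₁ ∷ wL) * δᵂ (b ∷ v) (letterOf e₂ ∷ wR)) (splits e)
      ≡⟨ ∑-cong (λ (e₁ , e₂) → cong₂ _*_ (δᵂ-∷ a u (letterOf e₁) wL) (δᵂ-∷ b v (letterOf e₂) wR)) (splits e) ⟩
    ∑ (λ (e₁ , e₂) → (δᴸ a (letterOf e₁) * δᵂ u wL) * (δᴸ b (letterOf e₂) * δᵂ v wR)) (splits e)
      ≡⟨ ∑-cong (λ (e₁ , e₂) → interchange (δᴸ a (letterOf e₁)) (δᵂ u wL) (δᴸ b (letterOf e₂)) (δᵂ v wR)) (splits e) ⟩
    ∑ (λ (e₁ , e₂) → (δᴸ a (letterOf e₁) * δᴸ b (letterOf e₂)) * (δᵂ u wL * δᵂ v wR)) (splits e)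
      ≡⟨ ∑-*ʳ (δᵂ u wL * δᵂ v wR) (λ (e₁ , e₂) → δᴸ a (letterOf e₁) * δᴸ b (letterOf e₂)) (splits e) ⟩
    ∑ (λ (e₁ , e₂) → δᴸ a (letterOf e₁) * δᴸ b (letterOf e₂)) (splits e) * (δᵂ u wL * δᵂ v wR)
      ≡⟨ cong (_* (δᵂ u wL * δᵂ v wR)) (∑-splits a b e) ⟩
    δᴸ (a ⊞ b) c * (δᵂ u wL * δᵂ v wR) ∎))
  where
  open ≡-Reasoning
  c = letterOf e

δ⊗ : ∀ {b} → Word → Word → BMon b × BMon b → ℚ
δ⊗ u v (L , R) = δᵂ u (wordOf L) * δᵂ v (wordOf R)

coeff-stuffleW : ∀ b t .(d : DecBelow b t) u v →
                 coeff (stuffleW u v) (W (map proj₂ t)) ≡ ∑ (δ⊗ u v) (factorsB b t d)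
coeff-stuffleW _ [] _ []      []      = ≡.refl
coeff-stuffleW _ [] _ []      (_ ∷ _) = ≡.refl
coeff-stuffleW _ [] _ (_ ∷ _) []      = ≡.refl
coeff-stuffleW _ [] _ (a ∷ u) (b ∷ v) =
  trans (coeff-++ X (Y ++ Z) [])
        (cong₂ _+_ (coeff-prepend-[] a (stuffleW u (b ∷ v)))
                   (trans (coeff-++ Y Z [])
                          (cong₂ _+_ (coeff-prepend-[] b (stuffleW (a ∷ u) v))
                                     (coeff-prepend-[] (a ⊞ b) (stuffleW u v)))))
  where
  X Y Z : 𝔄
  X = prepend a (stuffleW u (b ∷ v))
  Y = prepend b (stuffleW (a ∷ u) v)
  Z = prepend (a ⊞ b) (stuffleW u v)
coeff-stuffleW b ((i , e) ∷ r) d u v = begin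
  coeff (stuffleW u v) (c ∷ w)
    ≡⟨ coeff-stuffleW-∷ c w u v ⟩
  stuffleHead c (λ u′ v′ → coeff (stuffleW u′ v′) w) u v
    ≡⟨ stuffleHead-∑ c _ δ⊗ FR (coeff-stuffleW (fin i) r _) u v ⟩
  ∑ (λ p → stuffleHead c (λ u′ v′ → δ⊗ u′ v′ p) u v) FR
    ≡⟨ trans (∑-concatMap (δ⊗ u v) _ FR) (∑-cong placements FR) ⟨
  ∑ (δ⊗ u v) (factorsB b ((i , e) ∷ r) d) ∎
  where
  open ≡-Reasoning
  c = letterOf e
  w = W (map proj₂ r)
  FR = factorsB (fin i) r (proj₂ (proj₂ d))
  placements = λ (L , R) →
    trans (cong (λ z → δᵂ u (c ∷ wordOf L) * δᵂ v (wordOf R) + (δᵂ u (wordOf L) * δᵂ v (c ∷ wordOf R) + z))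
                (∑-map (δ⊗ u v) _ (splits e)))
          (stuffleHead-splits u v e (wordOf L) (wordOf R))

φ-cong : ∀ x x′ → x ≈𝔄 x′ → φ x ≗ₛ φ x′
φ-cong x x′ x≈x′ m = trans (φ-coeff x m) (trans (x≈x′ (wordOf m)) (sym (φ-coeff x′ m)))

φ-one : φ one𝔄 ≗ₛ oneₛ
φ-one m = trans (+-identityʳ _) (*-identityˡ _)

φ-++ : ∀ x x′ → φ (x +𝔄 x′) ≗ₛ (φ x +ₛ φ x′)
φ-++ x x′ m = begin
  φ (x ++ x′) m                    ≡⟨ φ-∑ (x ++ x′) m ⟩
  ∑ (term m) (x ++ x′)             ≡⟨ ∑-++ (term m) x x′ ⟩
  ∑ (term m) x + ∑ (term m) x′     ≡⟨ cong₂ _+_ (φ-∑ x m) (φ-∑ x′ m) ⟨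
  φ x m + φ x′ m                   ∎
  where
  open ≡-Reasoning
  term : Monomial → ℚ × Word → ℚ
  term m (q , u) = q * φW u m

φ-· : ∀ q x → φ (q ·𝔄 x) ≗ₛ (q ·ₛ φ x)
φ-· q []            m = sym (*-zeroʳ q)
φ-· q ((r , u) ∷ x) m = begin
  q * r * φW u m + φ (q ·𝔄 x) m     ≡⟨ cong₂ _+_ (ℚ.*-assoc q r (φW u m)) (φ-· q x m) ⟩
  q * (r * φW u m) + q * φ x m      ≡⟨ ℚ.*-distribˡ-+ q _ _ ⟨
  q * (r * φW u m + φ x m)          ∎
  where open ≡-Reasoning

φ-concatMap : ∀ {A : Set} (F : A → 𝔄) xs m → φ (concatMap F xs) m ≡ ∑ (λ a → φ (F a) m) xs
φ-concatMap F xs m = begin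
  φ (concatMap F xs) m                    ≡⟨ φ-∑ (concatMap F xs) m ⟩
  ∑ term (concatMap F xs)                 ≡⟨ ∑-concatMap term F xs ⟩
  ∑ (λ a → ∑ term (F a)) xs               ≡⟨ ∑-cong (λ a → φ-∑ (F a) m) xs ⟨
  ∑ (λ a → φ (F a) m) xs                  ∎
  where
  open ≡-Reasoning
  term : ℚ × Word → ℚ
  term (q , u) = q * φW u m

φ-stuffleW : ∀ u v → φ (stuffleW u v) ≗ₛ (φW u *ₛ φW v)
φ-stuffleW u v m@(mon t d) = begin
  φ (stuffleW u v) m                                        ≡⟨ φ-coeff (stuffleW u v) m ⟩
  coeff (stuffleW u v) (wordOf m)                           ≡⟨ coeff-stuffleW ∞ t d u v ⟩
  ∑ (δ⊗ u v) (factors m)                                    ≡⟨ ∑-cong (λ (m₁ , m₂) → cong₂ _*_ (φW-δ u m₁) (φW-δ v m₂)) (factors m) ⟨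
  ∑ (λ (m₁ , m₂) → φW u m₁ * φW v m₂) (factors m)           ∎
  where open ≡-Reasoning

φ-⋆ : ∀ x x′ → φ (x ⋆ x′) ≗ₛ (φ x *ₛ φ x′)
φ-⋆ x x′ m = begin
  φ (x ⋆ x′) m
    ≡⟨ φ-concatMap _ x m ⟩
  ∑ (λ a → φ (concatMap (λ (r , v) → (proj₁ a * r) ·𝔄 stuffleW (proj₂ a) v) x′) m) x
    ≡⟨ ∑-cong (λ (q , u) → trans (φ-concatMap _ x′ m) (∑-cong (λ (r , v) → expand q u r v) x′)) x ⟩
  ∑ (λ (q , u) → ∑ (λ (r , v) → ∑ (λ (m₁ , m₂) → term m₁ (q , u) * term m₂ (r , v)) FM) x′) x
    ≡⟨ ∑-cong (λ a → ∑-swap (λ b p → term (proj₁ p) a * term (proj₂ p) b) x′ FM) x ⟩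
  ∑ (λ a → ∑ (λ p → ∑ (λ b → term (proj₁ p) a * term (proj₂ p) b) x′) FM) x
    ≡⟨ ∑-swap (λ a p → ∑ (λ b → term (proj₁ p) a * term (proj₂ p) b) x′) x FM ⟩
  ∑ (λ p → ∑ (λ a → ∑ (λ b → term (proj₁ p) a * term (proj₂ p) b) x′) x) FM
    ≡⟨ ∑-cong (λ (m₁ , m₂) → ∑∑-* (term m₁) (term m₂) x x′) FM ⟩
  ∑ (λ (m₁ , m₂) → ∑ (term m₁) x * ∑ (term m₂) x′) FM
    ≡⟨ ∑-cong (λ (m₁ , m₂) → cong₂ _*_ (φ-∑ x m₁) (φ-∑ x′ m₂)) FM ⟨
  (φ x *ₛ φ x′) m ∎
  where
  open ≡-Reasoning
  FM = factors m
  term : Monomial → ℚ × Word → ℚ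
  term m (q , u) = q * φW u m
  expand : ∀ q u r v → φ ((q * r) ·𝔄 stuffleW u v) m
                       ≡ ∑ (λ (m₁ , m₂) → term m₁ (q , u) * term m₂ (r , v)) FM
  expand q u r v = begin
    φ ((q * r) ·𝔄 stuffleW u v) m                           ≡⟨ φ-· (q * r) (stuffleW u v) m ⟩
    q * r * φ (stuffleW u v) m                              ≡⟨ cong (q * r *_) (φ-stuffleW u v m) ⟩
    q * r * ∑ (λ (m₁ , m₂) → φW u m₁ * φW v m₂) FM          ≡⟨ ∑-*ˡ (q * r) _ FM ⟨
    ∑ (λ (m₁ , m₂) → q * r * (φW u m₁ * φW v m₂)) FM         ≡⟨ ∑-cong (λ (m₁ , m₂) → interchange q r (φW u m₁) (φW v m₂)) FM ⟩
    ∑ (λ (m₁ , m₂) → term m₁ (q , u) * term m₂ (r , v)) FM  ∎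

open ListSum ℤ.+-*-commutativeSemiring using () renaming (𝟙 to 𝟙ℤ; 𝟙-no to 𝟙ℤ-no)

-- a / suc m unfolds to fromℚᵘ (mkℚᵘ a m), so the sum can be computed in ℚᵘ.
/-+-/ : ∀ a m b n → a / suc m + b / suc n ≡ (a ℤ.* ℤ.+ suc n ℤ.+ b ℤ.* ℤ.+ suc m) / (suc m ℕ.* suc n)
/-+-/ a m b n = ℚ.toℚᵘ-injective (ℚᵘ.≃-trans
  (ℚ.toℚᵘ-homo-+ (a / suc m) (b / suc n))
  (ℚᵘ.≃-trans (ℚᵘ.+-cong (ℚ.toℚᵘ-fromℚᵘ (ℚᵘ.mkℚᵘ a m)) (ℚ.toℚᵘ-fromℚᵘ (ℚᵘ.mkℚᵘ b n)))
              (ℚᵘ.≃-sym (ℚ.toℚᵘ-fromℚᵘ (ℚᵘ.mkℚᵘ a m ℚᵘ.+ ℚᵘ.mkℚᵘ b n)))))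

degL : List 𝔻 → ℕ
degL s = sum (map ∣_∣ᴰ s)

deg-exps : ∀ m → deg m ≡ degL (exps m)
deg-exps m = cong sum (List.map-∘ (terms m))

IsQSym₂-0 : IsQSym₂ (λ _ → ℤ.0ℤ)
IsQSym₂-0 = (0 , λ _ _ → ≡.refl) , λ _ _ _ → ≡.refl

IsQSym₂-+ : ∀ {g h} → IsQSym₂ g → IsQSym₂ h → IsQSym₂ (λ m → g m ℤ.+ h m)
IsQSym₂-+ ((M , g-bounded) , g-qsym) ((N , h-bounded) , h-qsym) =
  (M ℕ.⊔ N , λ m M⊔N<deg → cong₂ ℤ._+_ (g-bounded m (ℕ.m⊔n<o⇒m<o M N M⊔N<deg))
                                        (h-bounded m (ℕ.m⊔n<o⇒n<o M N M⊔N<deg))) ,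
  λ m m′ eq → cong₂ ℤ._+_ (g-qsym m m′ eq) (h-qsym m m′ eq)

IsQSym₂-*ʳ : ∀ {g} k → IsQSym₂ g → IsQSym₂ (λ m → g m ℤ.* k)
IsQSym₂-*ʳ k ((N , bounded) , qsym) =
  (N , λ m N<deg → trans (cong (ℤ._* k) (bounded m N<deg)) (ℤ.*-zeroˡ k)) ,
  λ m m′ eq → cong (ℤ._* k) (qsym m m′ eq)

IsQSym₂-δ : ∀ u → IsQSym₂ (λ m → 𝟙ℤ (u ≟ᵂ wordOf m))
IsQSym₂-δ u = (degL (unW u) , bounded) , λ m m′ eq → cong (λ s → 𝟙ℤ (u ≟ᵂ W s)) eq
  where
  bounded : ∀ m → degL (unW u) < deg m → 𝟙ℤ (u ≟ᵂ wordOf m) ≡ ℤ.0ℤ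
  bounded m N<deg = 𝟙ℤ-no (u ≟ᵂ wordOf m) u≢
    where
    u≢ : u ≢ wordOf m
    u≢ ≡.refl = ℕ.<-irrefl (trans (cong degL (unW-W (exps m))) (sym (deg-exps m))) N<deg

InℚQSym₂-0 : InℚQSym₂ (λ _ → 0ℚ)
InℚQSym₂-0 = 0 , (λ _ → ℤ.0ℤ) , IsQSym₂-0 , λ _ → sym (ℚ.0/n≡0 1)

InℚQSym₂-+ : ∀ {f f′} → InℚQSym₂ f → InℚQSym₂ f′ → InℚQSym₂ (f +ₛ f′)
InℚQSym₂-+ (m , g , g-qsym , f≡g) (n , h , h-qsym , f′≡h) =
  _ , _ , IsQSym₂-+ (IsQSym₂-*ʳ (ℤ.+ suc n) g-qsym) (IsQSym₂-*ʳ (ℤ.+ suc m) h-qsym) ,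
  λ x → trans (cong₂ _+_ (f≡g x) (f′≡h x)) (/-+-/ (g x) m (h x) n)

*-𝟙-/ : ∀ q {P : Set} (p : Dec P) → q * 𝟙 p ≡ (𝟙ℤ p ℤ.* ↥ q) / ↧ₙ q
*-𝟙-/ q (yes _) = trans (ℚ.*-identityʳ q)
                        (trans (sym (ℚ.↥p/↧p≡p q)) (cong (_/ ↧ₙ q) (sym (ℤ.*-identityˡ (↥ q)))))
*-𝟙-/ q (no _)  = trans (*-zeroʳ q)
                        (trans (sym (ℚ.0/n≡0 (↧ₙ q))) (cong (_/ ↧ₙ q) (sym (ℤ.*-zeroˡ (↥ q)))))

InℚQSym₂-*φW : ∀ q u → InℚQSym₂ (λ m → q * φW u m)
InℚQSym₂-*φW q u =
  _ , _ , IsQSym₂-*ʳ (↥ q) (IsQSym₂-δ u) ,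
  λ m → trans (cong (q *_) (φW-δ u m)) (*-𝟙-/ q (u ≟ᵂ wordOf m))

InℚQSym₂-φ : ∀ x → InℚQSym₂ (φ x)
InℚQSym₂-φ []            = InℚQSym₂-0
InℚQSym₂-φ ((q , u) ∷ x) = InℚQSym₂-+ (InℚQSym₂-*φW q u) (InℚQSym₂-φ x)

canonical : List 𝔻 → Monomial
canonical s = weaken ∞ tt (mon (indexed s) (decreasing s))
  where
  indexed : List 𝔻 → List (ℕ × 𝔻)
  indexed []      = []
  indexed (e ∷ s) = (suc (length s) , e) ∷ indexed s
  decreasing : ∀ s → DecBelow (fin (suc (length s))) (indexed s)
  decreasing []      = tt
  decreasing (e ∷ s) = s≤s z≤n , ℕ.n<1+n (suc (length s)) , decreasing s

exps-canonical : ∀ s → exps (canonical s) ≡ s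
exps-canonical []      = ≡.refl
exps-canonical (e ∷ s) = cong (e ∷_) (exps-canonical s)

wordOf-canonical : ∀ w → wordOf (canonical (unW w)) ≡ w
wordOf-canonical w = trans (cong W (exps-canonical (unW w))) (W-unW w)

φ-injective : ∀ x x′ → φ x ≗ₛ φ x′ → x ≈𝔄 x′
φ-injective x x′ φx≗φx′ w = begin
  coeff x w             ≡⟨ cong (coeff x) (wordOf-canonical w) ⟨
  coeff x (wordOf m)    ≡⟨ φ-coeff x m ⟨
  φ x m                 ≡⟨ φx≗φx′ m ⟩
  φ x′ m                ≡⟨ φ-coeff x′ m ⟩
  coeff x′ (wordOf m)   ≡⟨ cong (coeff x′) (wordOf-canonical w) ⟩
  coeff x′ w            ∎
  where
  open ≡-Reasoning
  m = canonical (unW w)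

signedUpTo : ℕ → List 𝔻
signedUpTo n = concatMap (λ σ → map (sd σ) (upTo n)) signs

sequencesOfDegree≤ : ℕ → List (List 𝔻)
sequencesOfDegree≤ zero    = [ [] ]
sequencesOfDegree≤ (suc n) = [] ∷ concatMap (λ e → map (e ∷_) (sequencesOfDegree≤ n)) (signedUpTo (suc n))

∈-signs : ∀ σ → σ ∈ signs
∈-signs Sign.+ = here ≡.refl
∈-signs Sign.- = there (here ≡.refl)

∈-concatMap : ∀ {A B : Set} (f : A → List B) {x xs b} → x ∈ xs → b ∈ f x → b ∈ concatMap f xs
∈-concatMap f x∈xs b∈fx = ∈-concatMap⁺ f (Any.map (λ { ≡.refl → b∈fx }) x∈xs)

∈-sequencesOfDegree≤ : ∀ {N} s → degL s ≤ N → s ∈ sequencesOfDegree≤ N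
∈-sequencesOfDegree≤ {zero}  []             _           = here ≡.refl
∈-sequencesOfDegree≤ {suc N} []             _           = here ≡.refl
∈-sequencesOfDegree≤ {zero}  (sd _ _ ∷ _) ()
∈-sequencesOfDegree≤ {suc N} (sd σ k ∷ s) (s≤s k+s≤N) =
  there (∈-concatMap (λ e → map (e ∷_) (sequencesOfDegree≤ N))
           (∈-concatMap (λ σ → map (sd σ) (upTo (suc N))) (∈-signs σ)
                        (∈-map⁺ (sd σ) (∈-upTo⁺ (s≤s (ℕ.m+n≤o⇒m≤o k k+s≤N)))))
           (∈-map⁺ (sd σ k ∷_) (∈-sequencesOfDegree≤ s (ℕ.m+n≤o⇒n≤o k k+s≤N))))

open import Algebra.Properties.Group ℚ.+-0-group using (//-rightDividesˡ)

module _ (F : List 𝔻 → ℚ) where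

  -- Each term corrects the coefficient left by the later ones, so repetitions in the list are harmless.
  interpolate : List (List 𝔻) → 𝔄
  interpolate []       = []
  interpolate (s ∷ ss) = (F s - coeff (interpolate ss) (W s) , W s) ∷ interpolate ss

  coeff-interpolate-∉ : ∀ ss w → ¬ (unW w ∈ ss) → coeff (interpolate ss) w ≡ 0ℚ
  coeff-interpolate-∉ []       w _    = ≡.refl
  coeff-interpolate-∉ (s ∷ ss) w w∉ss with W s ≟ᵂ w
  ... | yes ≡.refl = contradiction (here (unW-W s)) w∉ss
  ... | no  _      = coeff-interpolate-∉ ss w (w∉ss ∘ there)

  coeff-interpolate-∈ : ∀ ss w → unW w ∈ ss → coeff (interpolate ss) w ≡ F (unW w)
  coeff-interpolate-∈ (s ∷ ss) w w∈ss with W s ≟ᵂ w | w∈ss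
  ... | yes ≡.refl | _          = trans (//-rightDividesˡ (coeff (interpolate ss) (W s)) (F s))
                                        (cong F (sym (unW-W s)))
  ... | no  W≢w    | here ≡.refl = contradiction (W-unW w) W≢w
  ... | no  _      | there w∈ss′ = coeff-interpolate-∈ ss w w∈ss′

InℚQSym₂⇒bounded : ∀ {f} → InℚQSym₂ f → ∃[ N ] (∀ m → N < deg m → f m ≡ 0ℚ)
InℚQSym₂⇒bounded (n , g , ((N , bounded) , _) , f≡g) =
  N , λ m N<deg → trans (f≡g m) (trans (cong (_/ suc n) (bounded m N<deg)) (ℚ.0/n≡0 (suc n)))

InℚQSym₂⇒quasiSymmetric : ∀ {f} → InℚQSym₂ f → ∀ m m′ → exps m ≡ exps m′ → f m ≡ f m′
InℚQSym₂⇒quasiSymmetric (n , g , (_ , qsym) , f≡g) m m′ eq =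
  trans (f≡g m) (trans (cong (_/ suc n) (qsym m m′ eq)) (sym (f≡g m′)))

φ-surjective : ∀ f N → (∀ m → N < deg m → f m ≡ 0ℚ) → (∀ m m′ → exps m ≡ exps m′ → f m ≡ f m′) →
               Σ 𝔄 λ x → φ x ≗ₛ f
φ-surjective f N bounded qsym = x , φx≗f
  where
  x = interpolate (f ∘ canonical) (sequencesOfDegree≤ N)
  φx≗f : φ x ≗ₛ f
  φx≗f m with unW (wordOf m) ∈? sequencesOfDegree≤ N | unW-W (exps m)
  ... | yes m∈ | unW-wordOf = begin
    φ x m                                ≡⟨ φ-coeff x m ⟩
    coeff x (wordOf m)                   ≡⟨ coeff-interpolate-∈ (f ∘ canonical) _ (wordOf m) m∈ ⟩
    f (canonical (unW (wordOf m)))       ≡⟨ qsym _ m (trans (exps-canonical _) unW-wordOf) ⟩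
    f m                                  ∎
    where open ≡-Reasoning
  ... | no m∉ | unW-wordOf = begin
    φ x m                                ≡⟨ φ-coeff x m ⟩
    coeff x (wordOf m)                   ≡⟨ coeff-interpolate-∉ (f ∘ canonical) _ (wordOf m) m∉ ⟩
    0ℚ                                   ≡⟨ bounded m (ℕ.≰⇒> deg≰N) ⟨
    f m                                  ∎
    where
    open ≡-Reasoning
    deg≰N : ¬ deg m ≤ N
    deg≰N deg≤N = m∉ (≡.subst (_∈ sequencesOfDegree≤ N) (sym unW-wordOf)
                              (∈-sequencesOfDegree≤ (exps m) (≡.subst (_≤ N) (deg-exps m) deg≤N)))

mainTheorem4 :
      (∀ x x′ → x ≈𝔄 x′ → φ x ≗ₛ φ x′)
    × (∀ x x′ → φ (x +𝔄 x′) ≗ₛ (φ x +ₛ φ x′))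
    × (∀ (q : ℚ) x → φ (q ·𝔄 x) ≗ₛ (q ·ₛ φ x))
    × (φ one𝔄 ≗ₛ oneₛ)
    × (∀ x x′ → φ (x ⋆ x′) ≗ₛ (φ x *ₛ φ x′))
    × (∀ x → InℚQSym₂ (φ x))
    × (∀ x x′ → φ x ≗ₛ φ x′ → x ≈𝔄 x′)
    × (∀ f → InℚQSym₂ f → Σ 𝔄 λ x → φ x ≗ₛ f)
mainTheorem4 =
    φ-cong
  , φ-++
  , φ-·
  , φ-one
  , φ-⋆
  , InℚQSym₂-φ
  , φ-injective
  , λ f f∈ → let N , bounded = InℚQSym₂⇒bounded f∈ in
             φ-surjective f N bounded (InℚQSym₂⇒quasiSymmetric f∈)
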